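{- Let $H \subseteq \binom{[n]}{4}$ be a design, let $u \in [n]$, let $r \geq 1$ be an integer, and let $Z \subseteq [n]$ with $|Z| = t$ for some $0 \leq t \leq r$. Then the number of chains $C \in \mathcal{H}_u^{(r)}$ with $Z \subseteq C_R$ is at most $\binom{r}{t}\, t!\,(3\delta n)^{r-t}\, 2^r$. Moreover, for any $w \in [n]$, the number of chains $C \in \mathcal{H}_u^{(r)}$ with tail $w$ and $Z \subseteq C_L$ is at most $\binom{r}{t}\, t!\,(3\delta n)^{r-t-1}\, 2^r$ if $t \leq r-1$, and at most $r!\, 2^r$ if $t = r$.
   Context: $H$ is a design: a family of $4$-element subsets of $[n]$ such that every pair of distinct elements of $[n]$ is contained in exactly one member of $H$. For $u \in [n]$ let $H_u = \{C \setminus \{u\} : C \in H, u \in C\}$, and $\delta = \frac13 - \frac{1}{3n}$ (so $|H_u| = \delta n$). An $r$-chain with head $u$ is an ordered sequence $C = (u_0, v_1, v_2, u_1, \dots, v_{2r-1}, v_{2r}, u_r)$ with $u_0 = u$, $v_1,\dots,v_{2r}$ all distinct, and $\{v_{2h+1}, v_{2h+2}, u_{h+1}\} \in H_{u_h}$ for $h = 0,\dots,r-1$; $C_L = \{v_1, v_3, \dots, v_{2r-1}\}$, $C_R = \{v_2, v_4, \dots, v_{2r}\}$, and $u_r$ is the tail. $\mathcal{H}_u^{(r)}$ is the set of such (ordered) chains. -}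

module Defs where

open import Data.Nat using (ℕ; zero; suc)
open import Data.Bool using (Bool; true; false)
open import Data.Bool.Properties using () renaming (_≟_ to _≟ᵇ_)
open import Data.Fin using (Fin)
open import Data.Fin.Properties using () renaming (_≟_ to _≟ᶠ_)
open import Data.Fin.Subset using (Subset; _∈_; _∉_; _∪_; ⁅_⁆; ⊥; ∣_∣; _⊆_)
open import Data.Fin.Subset.Properties using (_∈?_; _⊆?_)
open import Data.List using (List; []; _∷_; map; concatMap; allFin; cartesianProduct; filter; length; foldr)
open import Data.Product using (_×_; _,_; ∃!)
open import Data.Unit using (⊤; tt)
open import Relation.Nullary using (¬_; Dec; yes; no; ¬?)
open import Relation.Nullary.Decidable using (_×-dec_)
open import Relation.Binary.PropositionalEquality using (_≡_; _≢_)
open import Data.List.Relation.Unary.Unique.Propositional using (Unique)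
import Data.List.Relation.Unary.Unique.DecPropositional as UDec

Family : ℕ → Set
Family n = Subset n → Bool

_∈H_ : {n : ℕ} → Subset n → Family n → Set
S ∈H H = H S ≡ true

IsDesign : {n : ℕ} → Family n → Set
IsDesign {n} H =
  (∀ (S : Subset n) → S ∈H H → ∣ S ∣ ≡ 4) ×
  (∀ (x y : Fin n) → x ≢ y → ∃! _≡_ (λ S → S ∈H H × x ∈ S × y ∈ S))

triple : {n : ℕ} → Fin n → Fin n → Fin n → Subset n
triple a b c = ⁅ a ⁆ ∪ (⁅ b ⁆ ∪ ⁅ c ⁆)

-- T ∈ H_u  iff  T = C \ {u} for some C ∈ H with u ∈ C,  i.e.  u ∉ T and T ∪ {u} ∈ H
_∈Link[_,_] : {n : ℕ} → Subset n → Family n → Fin n → Set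
T ∈Link[ H , u ] = (u ∉ T) × ((T ∪ ⁅ u ⁆) ∈H H)

-- A chain (u₀, v₁, v₂, u₁, …, v₂ᵣ₋₁, v₂ᵣ, uᵣ) with head u₀ = u is encoded by the
-- list of its r steps (v₂ₕ₊₁ , v₂ₕ₊₂ , uₕ₊₁), h = 0, …, r-1.
Step : ℕ → Set
Step n = Fin n × Fin n × Fin n

vSeq : {n : ℕ} → List (Step n) → List (Fin n)
vSeq = concatMap (λ { (a , b , _) → a ∷ b ∷ [] })

Linked : {n : ℕ} → Family n → Fin n → List (Step n) → Set
Linked H u [] = ⊤
Linked H u ((a , b , c) ∷ cs) = (triple a b c ∈Link[ H , u ]) × Linked H c cs

IsChain : {n : ℕ} → Family n → Fin n → ℕ → List (Step n) → Set
IsChain H u r cs = (length cs ≡ r) × Unique (vSeq cs) × Linked H u cs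

fromList : {n : ℕ} → List (Fin n) → Subset n
fromList = foldr (λ x S → ⁅ x ⁆ ∪ S) ⊥

-- C_L = {v₁, v₃, …}, C_R = {v₂, v₄, …}, tail = uᵣ
CL : {n : ℕ} → List (Step n) → Subset n
CL cs = fromList (map (λ { (a , _ , _) → a }) cs)

CR : {n : ℕ} → List (Step n) → Subset n
CR cs = fromList (map (λ { (_ , b , _) → b }) cs)

tailOf : {n : ℕ} → Fin n → List (Step n) → Fin n
tailOf u [] = u
tailOf u ((_ , _ , c) ∷ cs) = tailOf c cs

allSteps : (n : ℕ) → List (Step n)
allSteps n = cartesianProduct (allFin n) (cartesianProduct (allFin n) (allFin n))

allStepLists : (n k : ℕ) → List (List (Step n))
allStepLists n zero = [] ∷ []
allStepLists n (suc k) =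
  map (λ { (s , cs) → s ∷ cs }) (cartesianProduct (allSteps n) (allStepLists n k))

∈Link? : {n : ℕ} (H : Family n) (u : Fin n) (T : Subset n) → Dec (T ∈Link[ H , u ])
∈Link? H u T = ¬? (u ∈? T) ×-dec (H (T ∪ ⁅ u ⁆) ≟ᵇ true)

Linked? : {n : ℕ} (H : Family n) (u : Fin n) (cs : List (Step n)) → Dec (Linked H u cs)
Linked? H u [] = yes tt
Linked? H u ((a , b , c) ∷ cs) = ∈Link? H u (triple a b c) ×-dec Linked? H c cs

IsChain? : {n : ℕ} (H : Family n) (u : Fin n) (r : ℕ) (cs : List (Step n)) → Dec (IsChain H u r cs)
IsChain? H u r cs =
  (Data.Nat._≟_ (length cs) r) ×-dec (UDec.unique? _≟ᶠ_ (vSeq cs) ×-dec Linked? H u cs)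

countR : {n : ℕ} → Family n → Fin n → ℕ → Subset n → ℕ
countR {n} H u r Z =
  length (filter (λ cs → IsChain? H u r cs ×-dec (Z ⊆? CR cs)) (allStepLists n r))

countL : {n : ℕ} → Family n → Fin n → ℕ → Fin n → Subset n → ℕ
countL {n} H u r w Z =
  length (filter (λ cs → IsChain? H u r cs ×-dec ((tailOf u cs ≟ᶠ w) ×-dec (Z ⊆? CL cs)))
                 (allStepLists n r))

{-# OPTIONS --safe #-}
-- Chains are over-counted by walks: linked step lists with no length or
-- distinctness condition. Since two points lie in exactly one block, fixing
-- any two of the four points u, a, b, c of a step {a, b, c} ∈ H_u leaves at
-- most two ordered choices for the other two, and fixing only u leaves at
-- most 2(n - 1) steps. Peeling off the first step, according to whether its
-- b lies in Z, the walks of length k with Z ⊆ C_R satisfy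
-- R(k+1, t) ≤ 2t R(k, t-1) + 2(n-1) R(k, t), solved by C(k,t) t! (n-1)^(k-t) 2^k.
-- Walks ending at w with Z ⊆ C_L obey the same recursion once summed over
-- all heads u, because a and c leave at most two choices of (u, b). For a
-- fixed head and |Z| ≤ k, walks of length k + 1 are bounded by induction on
-- k; when |Z| = k the remainder after the first step is bounded by that sum
-- over heads, which is where the fixed tail saves a factor n - 1.

module Submission where

open import Defs
open import Data.Bool.Base using (if_then_else_)
open import Data.Empty using (⊥-elim)
open import Data.Fin using (Fin; zero; suc)
open import Data.Fin.Properties using (any?) renaming (_≟_ to _≟ᶠ_)
open import Data.Fin.Subset using (Subset; _∈_; _∉_; _∪_; _─_; _-_; ⁅_⁆; ∁; ∣_∣; _⊆_; inside; outside)
  renaming (⊥ to ∅)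
open import Data.Fin.Subset.Properties
open import Data.List.Base using (List; []; _∷_; _++_; map; length; filter; cartesianProduct; tabulate; allFin)
open import Data.List.Properties using (filter-none; map-++; map-∘; map-cong; map-tabulate)
open import Data.List.Relation.Unary.All using (universal)
open import Data.Vec.Base using ([]; _∷_; here; there)
open import Data.Nat.Base using (ℕ; zero; suc; _+_; _*_; _∸_; _^_; _!; _≤_; _<_; _≥_; z≤n; s≤s)
open import Data.Nat.Properties
open import Data.Nat.Combinatorics using (_C_; k>n⇒nCk≡0; nCk+nC[k+1]≡[n+1]C[k+1]; nCn≡1; nCk≡nC[n∸k]; nC1≡n)
open import Data.Nat.Tactic.RingSolver using (solve-∀)
import Data.Nat.ListAction as Listℕ
open import Data.Nat.ListAction.Properties using (sum-++)
open import Algebra.Properties.Semiring.Sum +-*-semiring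
  using (sum; sum-syntax; sum-cong-≗; sum-replicate-zero; ∑-comm; ∑-distrib-+; *-distribˡ-sum; *-distribʳ-sum)
open import Data.Product using (_×_; _,_; proj₁; proj₂; swap)
open import Data.Sum as Sum using (_⊎_; inj₁; inj₂)
open import Data.Unit using (tt)
open import Function.Base using (_∘_; id)
open import Relation.Nullary using (¬_; Dec; yes; no; does)
open import Relation.Nullary.Decidable using (_×-dec_)
open import Relation.Unary using (Pred; Decidable)
open import Relation.Binary.PropositionalEquality
import Algebra.Solver.IdempotentCommutativeMonoid as ICM-Solver

-- Defined through does, so that 𝟙 (suc i ∈? x ∷ p) reduces to 𝟙 (i ∈? p).
𝟙 : ∀ {p} {P : Set p} → Dec P → ℕ
𝟙 d = if does d then 1 else 0

module _ {p} {P : Set p} where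

  𝟙-yes : (P? : Dec P) → P → 𝟙 P? ≡ 1
  𝟙-yes (yes _) _  = refl
  𝟙-yes (no ¬p) p = ⊥-elim (¬p p)

  𝟙-no : (P? : Dec P) → ¬ P → 𝟙 P? ≡ 0
  𝟙-no (yes p) ¬p = ⊥-elim (¬p p)
  𝟙-no (no _)  _  = refl

  𝟙≤1 : (P? : Dec P) → 𝟙 P? ≤ 1
  𝟙≤1 (yes _) = ≤-refl
  𝟙≤1 (no _)  = z≤n

  𝟙*-monoʳ-≤ : (P? : Dec P) {x y : ℕ} → (P → x ≤ y) → 𝟙 P? * x ≤ 𝟙 P? * y
  𝟙*-monoʳ-≤ (yes p) x≤y = *-monoʳ-≤ 1 (x≤y p)
  𝟙*-monoʳ-≤ (no _)  _   = z≤n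

  ≤-𝟙*-+ : (P? : Dec P) {x y z : ℕ} → (P → x ≤ y) → (¬ P → x ≤ z) → x ≤ 𝟙 P? * y + z
  ≤-𝟙*-+ (yes p) x≤y _   = ≤-trans (x≤y p) (≤-trans (≤-reflexive (sym (*-identityˡ _))) (m≤m+n _ _))
  ≤-𝟙*-+ (no ¬p) _   x≤z = x≤z ¬p

𝟙-mono : ∀ {p q} {P : Set p} {Q : Set q} (P? : Dec P) (Q? : Dec Q) → (P → Q) → 𝟙 P? ≤ 𝟙 Q?
𝟙-mono (yes p) Q? f = ≤-reflexive (sym (𝟙-yes Q? (f p)))
𝟙-mono (no _)  Q? f = z≤n

𝟙≤𝟙*𝟙 : ∀ {p q r} {P : Set p} {Q : Set q} {R : Set r} (P? : Dec P) (Q? : Dec Q) (R? : Dec R) →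
         (P → Q × R) → 𝟙 P? ≤ 𝟙 Q? * 𝟙 R?
𝟙≤𝟙*𝟙 (yes p) Q? R? P⇒QR =
  ≤-reflexive (sym (cong₂ _*_ (𝟙-yes Q? (proj₁ (P⇒QR p))) (𝟙-yes R? (proj₂ (P⇒QR p)))))
𝟙≤𝟙*𝟙 (no _)  Q? R? P⇒QR = z≤n

module _ {a} {A : Set a} where

  count : ∀ {p} {P : Pred A p} → Decidable P → List A → ℕ
  count P? xs = length (filter P? xs)

  count-mono : ∀ {p q} {P : Pred A p} {Q : Pred A q} (P? : Decidable P) (Q? : Decidable Q) →
               (∀ x → P x → Q x) → ∀ xs → count P? xs ≤ count Q? xs
  count-mono P? Q? P⇒Q [] = z≤n
  count-mono P? Q? P⇒Q (x ∷ xs) with P? x | Q? x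
  ... | yes _  | yes _  = s≤s (count-mono P? Q? P⇒Q xs)
  ... | yes px | no ¬qx = ⊥-elim (¬qx (P⇒Q x px))
  ... | no _   | yes _  = m≤n⇒m≤1+n (count-mono P? Q? P⇒Q xs)
  ... | no _   | no _   = count-mono P? Q? P⇒Q xs

  count-≤-𝟙* : ∀ {p q r} {P : Pred A p} {Q : Pred A q} {R : Set r}
               (P? : Decidable P) (Q? : Decidable Q) (R? : Dec R) →
               (∀ x → P x → R × Q x) → ∀ xs → count P? xs ≤ 𝟙 R? * count Q? xs
  count-≤-𝟙* P? Q? (yes r) P⇒RQ xs =
    ≤-trans (count-mono P? Q? (λ x → proj₂ ∘ P⇒RQ x) xs) (≤-reflexive (sym (*-identityˡ _)))
  count-≤-𝟙* P? Q? (no ¬r) P⇒RQ xs =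
    ≤-reflexive (cong length (filter-none P? (universal (λ x → ¬r ∘ proj₁ ∘ P⇒RQ x) xs)))

  count-[x] : ∀ {p} {P : Pred A p} (P? : Decidable P) x → count P? (x ∷ []) ≡ 𝟙 (P? x)
  count-[x] P? x with P? x
  ... | yes _ = refl
  ... | no _  = refl

  count≡sum𝟙 : ∀ {p} {P : Pred A p} (P? : Decidable P) xs → count P? xs ≡ Listℕ.sum (map (𝟙 ∘ P?) xs)
  count≡sum𝟙 P? [] = refl
  count≡sum𝟙 P? (x ∷ xs) with P? x
  ... | yes _ = cong suc (count≡sum𝟙 P? xs)
  ... | no _  = count≡sum𝟙 P? xs

sum-map-cartesianProduct : ∀ {a b} {A : Set a} {B : Set b} (h : A × B → ℕ) xs ys →
  Listℕ.sum (map h (cartesianProduct xs ys)) ≡ Listℕ.sum (map (λ x → Listℕ.sum (map (h ∘ (x ,_)) ys)) xs)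
sum-map-cartesianProduct h []       ys = refl
sum-map-cartesianProduct h (x ∷ xs) ys = begin
  Listℕ.sum (map h (map (x ,_) ys ++ cartesianProduct xs ys))
    ≡⟨ cong Listℕ.sum (map-++ h (map (x ,_) ys) _) ⟩
  Listℕ.sum (map h (map (x ,_) ys) ++ map h (cartesianProduct xs ys))
    ≡⟨ sum-++ (map h (map (x ,_) ys)) _ ⟩
  Listℕ.sum (map h (map (x ,_) ys)) + Listℕ.sum (map h (cartesianProduct xs ys))
    ≡⟨ cong₂ _+_ (cong Listℕ.sum (sym (map-∘ ys))) (sum-map-cartesianProduct h xs ys) ⟩
  Listℕ.sum (map (h ∘ (x ,_)) ys) + Listℕ.sum (map (λ x → Listℕ.sum (map (h ∘ (x ,_)) ys)) xs) ∎
  where open ≡-Reasoning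

sum-map-allFin : ∀ {n} (f : Fin n → ℕ) → Listℕ.sum (map f (allFin n)) ≡ ∑[ i < n ] f i
sum-map-allFin {n} f = trans (cong Listℕ.sum (map-tabulate id f)) (sum-tabulate f)
  where
  sum-tabulate : ∀ {m} (g : Fin m → ℕ) → Listℕ.sum (tabulate g) ≡ ∑[ i < m ] g i
  sum-tabulate {zero}  g = refl
  sum-tabulate {suc m} g = cong (g zero +_) (sum-tabulate (g ∘ suc))

∑-mono-≤ : ∀ {n} {f g : Fin n → ℕ} → (∀ i → f i ≤ g i) → ∑[ i < n ] f i ≤ ∑[ i < n ] g i
∑-mono-≤ {zero}  f≤g = z≤n
∑-mono-≤ {suc n} f≤g = +-mono-≤ (f≤g zero) (∑-mono-≤ (f≤g ∘ suc))

term≤∑ : ∀ {n} (f : Fin n → ℕ) i → f i ≤ ∑[ j < n ] f j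
term≤∑ f zero    = m≤m+n _ _
term≤∑ f (suc i) = ≤-trans (term≤∑ (f ∘ suc) i) (m≤n+m _ (f zero))

∑∑-*ʳ : ∀ {n} (f : Fin n → Fin n → ℕ) x →
        ∑[ i < n ] ∑[ j < n ] (f i j * x) ≡ (∑[ i < n ] ∑[ j < n ] f i j) * x
∑∑-*ʳ f x = sym (trans (*-distribʳ-sum x (λ i → sum (f i))) (sum-cong-≗ (λ i → *-distribʳ-sum x (f i))))

∑³ : ∀ {n} → (Fin n → Fin n → Fin n → ℕ) → ℕ
∑³ {n} f = ∑[ a < n ] ∑[ b < n ] ∑[ c < n ] f a b c

∑³-mono-≤ : ∀ {n} {f g : Fin n → Fin n → Fin n → ℕ} → (∀ a b c → f a b c ≤ g a b c) → ∑³ f ≤ ∑³ g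
∑³-mono-≤ f≤g = ∑-mono-≤ λ a → ∑-mono-≤ λ b → ∑-mono-≤ λ c → f≤g a b c

∑³-distrib-+ : ∀ {n} (f g : Fin n → Fin n → Fin n → ℕ) → ∑³ (λ a b c → f a b c + g a b c) ≡ ∑³ f + ∑³ g
∑³-distrib-+ {n} f g = trans
  (sum-cong-≗ {n} λ a → trans (sum-cong-≗ {n} λ b → ∑-distrib-+ (f a b) (g a b))
                              (∑-distrib-+ (λ b → sum (f a b)) (λ b → sum (g a b))))
  (∑-distrib-+ (λ a → ∑[ b < n ] sum (f a b)) (λ a → ∑[ b < n ] sum (g a b)))

∑³-*ʳ : ∀ {n} (f : Fin n → Fin n → Fin n → ℕ) x → ∑³ (λ a b c → f a b c * x) ≡ ∑³ f * x
∑³-*ʳ {n} f x = trans (sum-cong-≗ {n} λ a → ∑∑-*ʳ (f a) x) (sym (*-distribʳ-sum x (λ a → ∑[ b < n ] sum (f a b))))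

∑³-*-distrib : ∀ {n} (f g h : Fin n → Fin n → Fin n → ℕ) x →
  ∑³ (λ a b c → f a b c * (g a b c * x + h a b c)) ≡ ∑³ (λ a b c → f a b c * g a b c) * x + ∑³ (λ a b c → f a b c * h a b c)
∑³-*-distrib {n} f g h x = begin
  ∑³ (λ a b c → f a b c * (g a b c * x + h a b c))
    ≡⟨ sum-cong-≗ {n} (λ a → sum-cong-≗ {n} λ b → sum-cong-≗ {n} λ c → distrib (f a b c) (g a b c)) ⟩
  ∑³ (λ a b c → f a b c * g a b c * x + f a b c * h a b c)
    ≡⟨ ∑³-distrib-+ (λ a b c → f a b c * g a b c * x) (λ a b c → f a b c * h a b c) ⟩
  ∑³ (λ a b c → f a b c * g a b c * x) + ∑³ (λ a b c → f a b c * h a b c)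
    ≡⟨ cong (_+ ∑³ (λ a b c → f a b c * h a b c)) (∑³-*ʳ (λ a b c → f a b c * g a b c) x) ⟩
  ∑³ (λ a b c → f a b c * g a b c) * x + ∑³ (λ a b c → f a b c * h a b c) ∎
  where
  open ≡-Reasoning
  distrib : ∀ {y} p q → p * (q * x + y) ≡ p * q * x + p * y
  distrib {y} p q = trans (*-distribˡ-+ p (q * x) y) (cong (_+ p * y) (sym (*-assoc p q x)))

∑𝟙∈≡∣p∣ : ∀ {n} (p : Subset n) → ∑[ i < n ] 𝟙 (i ∈? p) ≡ ∣ p ∣
∑𝟙∈≡∣p∣ []            = refl
∑𝟙∈≡∣p∣ (inside  ∷ p) = cong suc (∑𝟙∈≡∣p∣ p)
∑𝟙∈≡∣p∣ (outside ∷ p) = ∑𝟙∈≡∣p∣ p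

∑𝟙∈*≤∣p∣* : ∀ {n} (p : Subset n) {f : Fin n → ℕ} {x} → (∀ {i} → i ∈ p → f i ≤ x) →
             ∑[ i < n ] (𝟙 (i ∈? p) * f i) ≤ ∣ p ∣ * x
∑𝟙∈*≤∣p∣* {n} p {f} {x} f≤x = begin
  ∑[ i < n ] (𝟙 (i ∈? p) * f i) ≤⟨ ∑-mono-≤ (λ i → 𝟙*-monoʳ-≤ (i ∈? p) f≤x) ⟩
  ∑[ i < n ] (𝟙 (i ∈? p) * x)   ≡⟨ *-distribʳ-sum x (λ i → 𝟙 (i ∈? p)) ⟨
  (∑[ i < n ] 𝟙 (i ∈? p)) * x   ≡⟨ cong (_* x) (∑𝟙∈≡∣p∣ p) ⟩
  ∣ p ∣ * x                     ∎
  where open ≤-Reasoning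

∑𝟙∈∁⁅x⁆ : ∀ {n} (x : Fin n) → ∑[ i < n ] 𝟙 (i ∈? ∁ ⁅ x ⁆) ≡ n ∸ 1
∑𝟙∈∁⁅x⁆ {n} x = trans (∑𝟙∈≡∣p∣ (∁ ⁅ x ⁆)) (trans (∣∁p∣≡n∸∣p∣ ⁅ x ⁆) (cong (n ∸_) (∣⁅x⁆∣≡1 x)))

∣p∪q∣≤∣p∣+∣q∣ : ∀ {n} (p q : Subset n) → ∣ p ∪ q ∣ ≤ ∣ p ∣ + ∣ q ∣
∣p∪q∣≤∣p∣+∣q∣ []            []            = z≤n
∣p∪q∣≤∣p∣+∣q∣ (inside  ∷ p) (inside  ∷ q) = s≤s (≤-trans (∣p∪q∣≤∣p∣+∣q∣ p q) (+-monoʳ-≤ ∣ p ∣ (n≤1+n _)))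
∣p∪q∣≤∣p∣+∣q∣ (inside  ∷ p) (outside ∷ q) = s≤s (∣p∪q∣≤∣p∣+∣q∣ p q)
∣p∪q∣≤∣p∣+∣q∣ (outside ∷ p) (inside  ∷ q) = ≤-trans (s≤s (∣p∪q∣≤∣p∣+∣q∣ p q)) (≤-reflexive (sym (+-suc _ _)))
∣p∪q∣≤∣p∣+∣q∣ (outside ∷ p) (outside ∷ q) = ∣p∪q∣≤∣p∣+∣q∣ p q

x∈p⇒1+∣p-x∣≡∣p∣ : ∀ {n} {x : Fin n} {p : Subset n} → x ∈ p → suc ∣ p - x ∣ ≡ ∣ p ∣
x∈p⇒1+∣p-x∣≡∣p∣ {p = inside ∷ p}  here        = cong (suc ∘ ∣_∣) (p─⊥≡p p)
x∈p⇒1+∣p-x∣≡∣p∣ {p = inside ∷ p}  (there x∈p) = cong suc (x∈p⇒1+∣p-x∣≡∣p∣ x∈p)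
x∈p⇒1+∣p-x∣≡∣p∣ {p = outside ∷ p} (there x∈p) = x∈p⇒1+∣p-x∣≡∣p∣ x∈p

x∈p⇒∣p-x∣≡∣p∣∸1 : ∀ {n} {x : Fin n} {p : Subset n} → x ∈ p → ∣ p - x ∣ ≡ ∣ p ∣ ∸ 1
x∈p⇒∣p-x∣≡∣p∣∸1 x∈p = cong (_∸ 1) (x∈p⇒1+∣p-x∣≡∣p∣ x∈p)

x∉p⇒p-x≡p : ∀ {n} {x : Fin n} {p : Subset n} → x ∉ p → p - x ≡ p
x∉p⇒p-x≡p {x = x} {p} x∉p = ⊆-antisym (p─q⊆p p ⁅ x ⁆) λ y∈p →
  x∈p∧x≢y⇒x∈p-y y∈p λ { refl → x∉p y∈p }

x∈p─q⇒x∉q : ∀ {n} {x : Fin n} (p q : Subset n) → x ∈ p ─ q → x ∉ q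
x∈p─q⇒x∉q (inside ∷ p) (outside ∷ q) here        ()
x∈p─q⇒x∉q (_      ∷ p) (inside  ∷ q) (there x∈) (there x∈q) = x∈p─q⇒x∉q p q x∈ x∈q
x∈p─q⇒x∉q (_      ∷ p) (outside ∷ q) (there x∈) (there x∈q) = x∈p─q⇒x∉q p q x∈ x∈q

p⊆⁅x⁆∪q⇒p-x⊆q : ∀ {n} {x : Fin n} {p q : Subset n} → p ⊆ ⁅ x ⁆ ∪ q → p - x ⊆ q
p⊆⁅x⁆∪q⇒p-x⊆q {x = x} {p} {q} p⊆x∪q {y} y∈p-x with x∈p∪q⁻ ⁅ x ⁆ q (p⊆x∪q (p─q⊆p p ⁅ x ⁆ y∈p-x))
... | inj₁ y∈⁅x⁆ = ⊥-elim (x∈p─q⇒x∉q p ⁅ x ⁆ y∈p-x y∈⁅x⁆)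
... | inj₂ y∈q   = y∈q

x≢y⇒x∈∁⁅y⁆ : ∀ {n} {x y : Fin n} → x ≢ y → x ∈ ∁ ⁅ y ⁆
x≢y⇒x∈∁⁅y⁆ = x∉p⇒x∈∁p ∘ x≢y⇒x∉⁅y⁆

p⊆∅⇒∣p∣≡0 : ∀ {n} {p : Subset n} → p ⊆ ∅ → ∣ p ∣ ≡ 0
p⊆∅⇒∣p∣≡0 {n} p⊆∅ = n≤0⇒n≡0 (≤-trans (p⊆q⇒∣p∣≤∣q∣ p⊆∅) (≤-reflexive (∣⊥∣≡0 n)))

∑𝟙∈⁅x⁆ : ∀ {n} (x : Fin n) → ∑[ i < n ] 𝟙 (i ∈? ⁅ x ⁆) ≡ 1
∑𝟙∈⁅x⁆ x = trans (∑𝟙∈≡∣p∣ ⁅ x ⁆) (∣⁅x⁆∣≡1 x)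

∑∑0≡0 : ∀ n → ∑[ i < n ] ∑[ j < n ] 0 ≡ 0
∑∑0≡0 n = trans (sum-cong-≗ {n} (λ _ → sum-replicate-zero n)) (sum-replicate-zero n)

UniqueUpToSwap : ∀ {n r} → (Fin n → Fin n → Set r) → Set r
UniqueUpToSwap R = ∀ {p q p′ q′} → R p q → R p′ q′ → (p ≡ p′ × q ≡ q′) ⊎ (p ≡ q′ × q ≡ p′)

module _ {n r d} {R : Fin n → Fin n → Set r} {D : Set d} where

  ∑∑𝟙≤2*𝟙 : (R? : ∀ p q → Dec (R p q)) (D? : Dec D) → UniqueUpToSwap R → (∀ {p q} → R p q → D) →
            ∑[ p < n ] ∑[ q < n ] 𝟙 (R? p q) ≤ 2 * 𝟙 D?
  ∑∑𝟙≤2*𝟙 R? D? unique R⇒D with any? (λ p → any? (R? p))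
  ... | no ∄R = ≤-trans (∑-mono-≤ λ p → ∑-mono-≤ λ q → ≤-reflexive (𝟙-no (R? p q) (λ r → ∄R (p , q , r))))
                        (≤-trans (≤-reflexive (∑∑0≡0 n)) z≤n)
  ... | yes (p₀ , q₀ , r₀) = begin
    ∑[ p < n ] ∑[ q < n ] 𝟙 (R? p q)
      ≤⟨ ∑-mono-≤ (λ p → ∑-mono-≤ (λ q → 𝟙R≤δ p q)) ⟩
    ∑[ p < n ] ∑[ q < n ] (δ p₀ p * δ q₀ q + δ q₀ p * δ p₀ q)
      ≡⟨ sum-cong-≗ (λ p → trans (∑-distrib-+ (λ q → δ p₀ p * δ q₀ q) (λ q → δ q₀ p * δ p₀ q))
                                 (cong₂ _+_ (δ*∑δ p₀ q₀ p) (δ*∑δ q₀ p₀ p))) ⟩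
    ∑[ p < n ] (δ p₀ p + δ q₀ p)
      ≡⟨ trans (∑-distrib-+ (δ p₀) (δ q₀)) (cong₂ _+_ (∑𝟙∈⁅x⁆ p₀) (∑𝟙∈⁅x⁆ q₀)) ⟩
    2
      ≡⟨ cong (2 *_) (𝟙-yes D? (R⇒D r₀)) ⟨
    2 * 𝟙 D? ∎
    where
    open ≤-Reasoning
    δ : Fin n → Fin n → ℕ
    δ x i = 𝟙 (i ∈? ⁅ x ⁆)
    δ*∑δ : ∀ x y p → ∑[ q < n ] (δ x p * δ y q) ≡ δ x p
    δ*∑δ x y p = trans (sym (*-distribˡ-sum (δ x p) (δ y))) (trans (cong (δ x p *_) (∑𝟙∈⁅x⁆ y)) (*-identityʳ _))
    δ-diag : ∀ p q → δ p p * δ q q ≡ 1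
    δ-diag p q = cong₂ _*_ (𝟙-yes (p ∈? ⁅ p ⁆) (x∈⁅x⁆ p)) (𝟙-yes (q ∈? ⁅ q ⁆) (x∈⁅x⁆ q))
    𝟙R≤δ : ∀ p q → 𝟙 (R? p q) ≤ δ p₀ p * δ q₀ q + δ q₀ p * δ p₀ q
    𝟙R≤δ p q with R? p q
    ... | no _ = z≤n
    ... | yes r with unique r r₀
    ...   | inj₁ (refl , refl) = ≤-trans (≤-reflexive (sym (δ-diag p q)))
                                        (m≤m+n _ _)
    ...   | inj₂ (refl , refl) = ≤-trans (≤-reflexive (sym (δ-diag p q)))
                                        (m≤n+m _ _)

-- Links of a design

module ∪-Solver {n} = ICM-Solver (∪-idempotentCommutativeMonoid n)
open ∪-Solver using (solve; _⊕_; _⊜_)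

module _ {n : ℕ} {a b c : Fin n} where

  a∈triple : a ∈ triple a b c
  a∈triple = x∈p∪q⁺ (inj₁ (x∈⁅x⁆ a))

  b∈triple : b ∈ triple a b c
  b∈triple = x∈p∪q⁺ (inj₂ (x∈p∪q⁺ (inj₁ (x∈⁅x⁆ b))))

  c∈triple : c ∈ triple a b c
  c∈triple = x∈p∪q⁺ (inj₂ (x∈p∪q⁺ (inj₂ (x∈⁅x⁆ c))))

  ∈triple⁻ : ∀ {y} → y ∈ triple a b c → y ≡ a ⊎ y ≡ b ⊎ y ≡ c
  ∈triple⁻ y∈ with x∈p∪q⁻ ⁅ a ⁆ _ y∈
  ... | inj₁ y∈a = inj₁ (x∈⁅y⁆⇒x≡y a y∈a)
  ... | inj₂ y∈bc with x∈p∪q⁻ ⁅ b ⁆ ⁅ c ⁆ y∈bc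
  ...   | inj₁ y∈b = inj₂ (inj₁ (x∈⁅y⁆⇒x≡y b y∈b))
  ...   | inj₂ y∈c = inj₂ (inj₂ (x∈⁅y⁆⇒x≡y c y∈c))

  ∉triple : ∀ {y} → y ≢ a → y ≢ b → y ≢ c → y ∉ triple a b c
  ∉triple y≢a y≢b y≢c y∈ with ∈triple⁻ y∈
  ... | inj₁ y≡a        = y≢a y≡a
  ... | inj₂ (inj₁ y≡b) = y≢b y≡b
  ... | inj₂ (inj₂ y≡c) = y≢c y≡c

  ∣triple∣≤3 : ∣ triple a b c ∣ ≤ 3
  ∣triple∣≤3 = ≤-trans (∣p∪q∣≤∣p∣+∣q∣ ⁅ a ⁆ _) (+-mono-≤ (≤-reflexive (∣⁅x⁆∣≡1 a))
                 (≤-trans (∣p∪q∣≤∣p∣+∣q∣ ⁅ b ⁆ ⁅ c ⁆) (≤-reflexive (cong₂ _+_ (∣⁅x⁆∣≡1 b) (∣⁅x⁆∣≡1 c)))))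

module Design {n : ℕ} (H : Family n) (isDesign : IsDesign H) where

  Link : Fin n → Fin n → Fin n → Fin n → Set
  Link u a b c = triple a b c ∈Link[ H , u ]

  link? : ∀ u a b c → Dec (Link u a b c)
  link? u a b c = ∈Link? H u (triple a b c)

  link : Fin n → Fin n → Fin n → Fin n → ℕ
  link u a b c = 𝟙 (link? u a b c)

  Link-swap : ∀ {u a b c} → Link u a b c → Link u b a c
  Link-swap {u} {a} {b} {c} (u∉ , inH) = subst (λ T → T ∈Link[ H , u ]) eq (u∉ , inH)
    where
    eq : triple a b c ≡ triple b a c
    eq = solve 3 (λ a b c → a ⊕ (b ⊕ c) ⊜ b ⊕ (a ⊕ c)) refl ⁅ a ⁆ ⁅ b ⁆ ⁅ c ⁆

  Link-rotate : ∀ {u a b c} → Link u a b c → Link u c a b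
  Link-rotate {u} {a} {b} {c} (u∉ , inH) = subst (λ T → T ∈Link[ H , u ]) eq (u∉ , inH)
    where
    eq : triple a b c ≡ triple c a b
    eq = solve 3 (λ a b c → a ⊕ (b ⊕ c) ⊜ c ⊕ (a ⊕ b)) refl ⁅ a ⁆ ⁅ b ⁆ ⁅ c ⁆

  Link⇒a≢b : ∀ {u a b c} → Link u a b c → a ≢ b
  Link⇒a≢b {u} {a} {_} {c} (_ , inH) refl = <⇒≱ (n<1+n 3) (begin
    4                          ≡⟨ proj₁ isDesign _ inH ⟨
    ∣ triple a a c ∪ ⁅ u ⁆ ∣  ≡⟨ cong ∣_∣ (solve 3 (λ a c u → (a ⊕ (a ⊕ c)) ⊕ u ⊜ a ⊕ (c ⊕ u)) refl ⁅ a ⁆ ⁅ c ⁆ ⁅ u ⁆) ⟩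
    ∣ triple a c u ∣          ≤⟨ ∣triple∣≤3 {a = a} {c} {u} ⟩
    3                          ∎)
    where open ≤-Reasoning

  Link⇒a≢c : ∀ {u a b c} → Link u a b c → a ≢ c
  Link⇒a≢c L = Link⇒a≢b (Link-rotate L) ∘ sym

  Link⇒b≢c : ∀ {u a b c} → Link u a b c → b ≢ c
  Link⇒b≢c L = Link⇒a≢b (Link-rotate (Link-swap L)) ∘ sym

  Link⇒u≢a : ∀ {u a b c} → Link u a b c → u ≢ a
  Link⇒u≢a (u∉ , _) refl = u∉ a∈triple

  Link⇒u≢b : ∀ {u a b c} → Link u a b c → u ≢ b
  Link⇒u≢b (u∉ , _) refl = u∉ b∈triple

  Link⇒u≢c : ∀ {u a b c} → Link u a b c → u ≢ c
  Link⇒u≢c (u∉ , _) refl = u∉ c∈triple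

  Link-exchange : ∀ {u a b c} → Link u a b c → Link c a b u
  Link-exchange {u} {a} {b} {c} L@(_ , inH) =
    ∉triple (Link⇒a≢c L ∘ sym) (Link⇒b≢c L ∘ sym) (Link⇒u≢c L ∘ sym) ,
    subst (_∈H H) (solve 4 (λ a b c u → (a ⊕ (b ⊕ c)) ⊕ u ⊜ (a ⊕ (b ⊕ u)) ⊕ c) refl ⁅ a ⁆ ⁅ b ⁆ ⁅ c ⁆ ⁅ u ⁆)
      inH

  Link-unique : ∀ {u a} → UniqueUpToSwap (Link u a)
  Link-unique {u} {a} {p} {q} {p′} {q′} L L′
    with other-two (x∈p∪q⁺ (inj₁ b∈triple)) (Link⇒a≢b L ∘ sym) (Link⇒u≢b L ∘ sym)
       | other-two (x∈p∪q⁺ (inj₁ c∈triple)) (Link⇒a≢c L ∘ sym) (Link⇒u≢c L ∘ sym)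
    where
    same-block : triple a p q ∪ ⁅ u ⁆ ≡ triple a p′ q′ ∪ ⁅ u ⁆
    same-block with proj₂ isDesign a u (Link⇒u≢a L ∘ sym)
    ... | _ , _ , unique = trans (sym (unique (proj₂ L  , x∈p∪q⁺ (inj₁ a∈triple) , x∈p∪q⁺ (inj₂ (x∈⁅x⁆ u)))))
                                 (unique (proj₂ L′ , x∈p∪q⁺ (inj₁ a∈triple) , x∈p∪q⁺ (inj₂ (x∈⁅x⁆ u))))
    other-two : ∀ {y} → y ∈ triple a p q ∪ ⁅ u ⁆ → y ≢ a → y ≢ u → y ≡ p′ ⊎ y ≡ q′
    other-two y∈ y≢a y≢u with x∈p∪q⁻ (triple a p′ q′) ⁅ u ⁆ (subst (_ ∈_) same-block y∈)
    ... | inj₂ y∈u = ⊥-elim (y≢u (x∈⁅y⁆⇒x≡y u y∈u))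
    ... | inj₁ y∈T with ∈triple⁻ y∈T
    ...   | inj₁ y≡a = ⊥-elim (y≢a y≡a)
    ...   | inj₂ y≡p′⊎q′ = y≡p′⊎q′
  ... | inj₁ p≡p′ | inj₂ q≡q′ = inj₁ (p≡p′ , q≡q′)
  ... | inj₂ p≡q′ | inj₁ q≡p′ = inj₂ (p≡q′ , q≡p′)
  ... | inj₁ p≡p′ | inj₁ q≡p′ = ⊥-elim (Link⇒b≢c L (trans p≡p′ (sym q≡p′)))
  ... | inj₂ p≡q′ | inj₂ q≡q′ = ⊥-elim (Link⇒b≢c L (trans p≡q′ (sym q≡q′)))

  ∑∑link-bc : ∀ u a → ∑[ b < n ] ∑[ c < n ] link u a b c ≤ 2 * 𝟙 (a ∈? ∁ ⁅ u ⁆)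
  ∑∑link-bc u a = ∑∑𝟙≤2*𝟙 (link? u a) (a ∈? ∁ ⁅ u ⁆) Link-unique (x≢y⇒x∈∁⁅y⁆ ∘ (_∘ sym) ∘ Link⇒u≢a)

  ∑∑link-ac : ∀ u b → ∑[ a < n ] ∑[ c < n ] link u a b c ≤ 2
  ∑∑link-ac u b = ∑∑𝟙≤2*𝟙 (λ a c → link? u a b c) (yes tt)
    (λ L L′ → Link-unique (Link-swap L) (Link-swap L′)) (λ _ → tt)

  ∑∑link-ab : ∀ u c → ∑[ a < n ] ∑[ b < n ] link u a b c ≤ 2
  ∑∑link-ab u c = ∑∑𝟙≤2*𝟙 (λ a b → link? u a b c) (yes tt)
    (λ L L′ → Link-unique (Link-rotate L) (Link-rotate L′)) (λ _ → tt)

  ∑∑link-ub : ∀ a c → ∑[ u < n ] ∑[ b < n ] link u a b c ≤ 2 * 𝟙 (a ∈? ∁ ⁅ c ⁆)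
  ∑∑link-ub a c = ∑∑𝟙≤2*𝟙 (λ u b → link? u a b c) (a ∈? ∁ ⁅ c ⁆)
    (λ L L′ → Sum.map swap swap (Link-unique (Link-exchange L) (Link-exchange L′))) (x≢y⇒x∈∁⁅y⁆ ∘ Link⇒a≢c)

  private
    ∑∑∑*𝟙∈≤2* : ∀ (g : Fin n → Fin n → Fin n → ℕ) Z → (∀ x → ∑[ y < n ] ∑[ z < n ] g x y z ≤ 2) →
                ∑³ (λ x y z → g x y z * 𝟙 (x ∈? Z)) ≤ 2 * ∣ Z ∣
    ∑∑∑*𝟙∈≤2* g Z ∑∑g≤2 = begin
      ∑³ (λ x y z → g x y z * 𝟙 (x ∈? Z))
        ≡⟨ sum-cong-≗ {n} (λ x → trans (∑∑-*ʳ (g x) (𝟙 (x ∈? Z))) (*-comm _ (𝟙 (x ∈? Z)))) ⟩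
      ∑[ x < n ] (𝟙 (x ∈? Z) * ∑[ y < n ] ∑[ z < n ] g x y z)
        ≤⟨ ∑𝟙∈*≤∣p∣* Z (λ {x} _ → ∑∑g≤2 x) ⟩
      ∣ Z ∣ * 2
        ≡⟨ *-comm ∣ Z ∣ 2 ⟩
      2 * ∣ Z ∣ ∎
      where open ≤-Reasoning

  ∑³link≤2[n∸1] : ∀ u → ∑³ (link u) ≤ 2 * (n ∸ 1)
  ∑³link≤2[n∸1] u = begin
    ∑³ (link u)                           ≤⟨ ∑-mono-≤ (∑∑link-bc u) ⟩
    ∑[ a < n ] (2 * 𝟙 (a ∈? ∁ ⁅ u ⁆))   ≡⟨ *-distribˡ-sum 2 (λ a → 𝟙 (a ∈? ∁ ⁅ u ⁆)) ⟨
    2 * ∑[ a < n ] 𝟙 (a ∈? ∁ ⁅ u ⁆)     ≡⟨ cong (2 *_) (∑𝟙∈∁⁅x⁆ u) ⟩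
    2 * (n ∸ 1)                           ∎
    where open ≤-Reasoning

  ∑³link*𝟙[a∈Z] : ∀ u Z → ∑³ (λ a b c → link u a b c * 𝟙 (a ∈? Z)) ≤ 2 * ∣ Z ∣
  ∑³link*𝟙[a∈Z] u Z = ∑∑∑*𝟙∈≤2* (link u) Z λ a →
    ≤-trans (∑∑link-bc u a) (*-monoʳ-≤ 2 (𝟙≤1 (a ∈? ∁ ⁅ u ⁆)))

  ∑³link*𝟙[b∈Z] : ∀ u Z → ∑³ (λ a b c → link u a b c * 𝟙 (b ∈? Z)) ≤ 2 * ∣ Z ∣
  ∑³link*𝟙[b∈Z] u Z = begin
    ∑³ (λ a b c → link u a b c * 𝟙 (b ∈? Z))
      ≡⟨ ∑-comm (λ a b → ∑[ c < n ] (link u a b c * 𝟙 (b ∈? Z))) ⟩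
    ∑³ (λ b a c → link u a b c * 𝟙 (b ∈? Z))
      ≤⟨ ∑∑∑*𝟙∈≤2* (λ b a c → link u a b c) Z (∑∑link-ac u) ⟩
    2 * ∣ Z ∣ ∎
    where open ≤-Reasoning

  ∑³link*[c] : ∀ u (Y : Fin n → ℕ) → ∑³ (λ a b c → link u a b c * Y c) ≤ 2 * ∑[ c < n ] Y c
  ∑³link*[c] u Y = begin
    ∑³ (λ a b c → link u a b c * Y c)
      ≡⟨ sum-cong-≗ {n} (λ a → ∑-comm (λ b c → link u a b c * Y c)) ⟩
    ∑[ a < n ] ∑[ c < n ] ∑[ b < n ] (link u a b c * Y c)
      ≡⟨ ∑-comm (λ a c → ∑[ b < n ] (link u a b c * Y c)) ⟩
    ∑[ c < n ] ∑[ a < n ] ∑[ b < n ] (link u a b c * Y c)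
      ≡⟨ sum-cong-≗ {n} (λ c → ∑∑-*ʳ (λ a b → link u a b c) (Y c)) ⟩
    ∑[ c < n ] ((∑[ a < n ] ∑[ b < n ] link u a b c) * Y c)
      ≤⟨ ∑-mono-≤ (λ c → *-monoˡ-≤ (Y c) (∑∑link-ab u c)) ⟩
    ∑[ c < n ] (2 * Y c)
      ≡⟨ *-distribˡ-sum 2 Y ⟨
    2 * ∑[ c < n ] Y c ∎
    where open ≤-Reasoning

  ∑∑³link*[a,c] : ∀ (G : Fin n → Fin n → ℕ) →
    ∑[ u < n ] ∑³ (λ a b c → link u a b c * G a c) ≤ ∑[ a < n ] ∑[ c < n ] (2 * 𝟙 (a ∈? ∁ ⁅ c ⁆) * G a c)
  ∑∑³link*[a,c] G = begin
    ∑[ u < n ] ∑³ (λ a b c → link u a b c * G a c)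
      ≡⟨ ∑-comm (λ u a → ∑[ b < n ] ∑[ c < n ] (link u a b c * G a c)) ⟩
    ∑[ a < n ] ∑[ u < n ] ∑[ b < n ] ∑[ c < n ] (link u a b c * G a c)
      ≡⟨ sum-cong-≗ {n} (λ a → trans (sum-cong-≗ {n} λ u → ∑-comm (λ b c → link u a b c * G a c))
                                    (∑-comm (λ u c → ∑[ b < n ] (link u a b c * G a c)))) ⟩
    ∑[ a < n ] ∑[ c < n ] ∑[ u < n ] ∑[ b < n ] (link u a b c * G a c)
      ≡⟨ sum-cong-≗ {n} (λ a → sum-cong-≗ {n} λ c → ∑∑-*ʳ (λ u b → link u a b c) (G a c)) ⟩
    ∑[ a < n ] ∑[ c < n ] ((∑[ u < n ] ∑[ b < n ] link u a b c) * G a c)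
      ≤⟨ ∑-mono-≤ (λ a → ∑-mono-≤ λ c → *-monoˡ-≤ (G a c) (∑∑link-ub a c)) ⟩
    ∑[ a < n ] ∑[ c < n ] (2 * 𝟙 (a ∈? ∁ ⁅ c ⁆) * G a c) ∎
    where open ≤-Reasoning

[1+n]Cn≡1+n : ∀ n → suc n C n ≡ suc n
[1+n]Cn≡1+n n = trans (nCk≡nC[n∸k] (n≤1+n n)) (trans (cong (suc n C_) (m+n∸n≡m 1 n)) (nC1≡n (suc n)))

-- m stands for 3δn = n - 1.
module WalkBounds (m : ℕ) where

  arrangements : ℕ → ℕ → ℕ → ℕ
  arrangements N t e = (N C t) * (t !) * m ^ e

  m*m^[k∸1+s] : ∀ {k s} → s < k → m * m ^ (k ∸ suc s) ≡ m ^ (k ∸ s)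
  m*m^[k∸1+s] s<k = cong (m ^_) (sym (+-∸-assoc 1 s<k))

  m*m^[k∸1+s]*kC[1+s] : ∀ k s → m * m ^ (k ∸ suc s) * (k C suc s) ≡ m ^ (k ∸ s) * (k C suc s)
  m*m^[k∸1+s]*kC[1+s] k s with s <? k
  ... | yes s<k = cong (_* (k C suc s)) (m*m^[k∸1+s] s<k)
  ... | no  s≮k rewrite k>n⇒nCk≡0 {k} {suc s} (s≤s (≮⇒≥ s≮k)) =
    trans (*-zeroʳ (m * m ^ (k ∸ suc s))) (sym (*-zeroʳ (m ^ (k ∸ s))))

  arrangements-pascal : ∀ N s e e′ → m * m ^ e′ * (N C suc s) ≡ m ^ e * (N C suc s) →
    suc s * arrangements N s e + m * arrangements N (suc s) e′ ≡ arrangements (suc N) (suc s) e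
  arrangements-pascal N s e e′ shift = begin
    suc s * ((N C s) * (s !) * m ^ e) + m * ((N C suc s) * (suc s !) * m ^ e′)
      ≡⟨ regroup (suc s) (s !) (N C s) (N C suc s) (m ^ e) (m ^ e′) m ⟩
    (N C s) * (suc s !) * m ^ e + (suc s !) * (m * m ^ e′ * (N C suc s))
      ≡⟨ cong (λ x → (N C s) * (suc s !) * m ^ e + (suc s !) * x) shift ⟩
    (N C s) * (suc s !) * m ^ e + (suc s !) * (m ^ e * (N C suc s))
      ≡⟨ collect (N C s) (N C suc s) (suc s !) (m ^ e) ⟩
    (N C s + N C suc s) * (suc s !) * m ^ e
      ≡⟨ cong (λ x → x * (suc s !) * m ^ e) (nCk+nC[k+1]≡[n+1]C[k+1] N s) ⟩
    (suc N C suc s) * (suc s !) * m ^ e ∎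
    where
    open ≡-Reasoning
    regroup : ∀ t f c₀ c₁ M M′ m → t * (c₀ * f * M) + m * (c₁ * (t * f) * M′)
                                   ≡ c₀ * (t * f) * M + t * f * (m * M′ * c₁)
    regroup = solve-∀
    collect : ∀ c₀ c₁ f M → c₀ * f * M + f * (M * c₁) ≡ (c₀ + c₁) * f * M
    collect = solve-∀

  arrangements-zero : ∀ N e → m * arrangements N 0 e ≡ arrangements (suc N) 0 (suc e)
  arrangements-zero N e = lemma m (m ^ e)
    where
    lemma : ∀ m M → m * (1 * 1 * M) ≡ 1 * 1 * (m * M)
    lemma = solve-∀

  walkBound : ℕ → ℕ → ℕ
  walkBound k t = arrangements k t (k ∸ t) * 2 ^ k

  walkBound-zero : ∀ t → walkBound 0 t ≡ 𝟙 (t ≟ 0)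
  walkBound-zero zero    = refl
  walkBound-zero (suc t) = refl

  tailWalkBound : ℕ → ℕ → ℕ
  tailWalkBound k t = arrangements (suc k) t (k ∸ t) * 2 ^ suc k

  private
    double : ∀ t m X Y T → 2 * t * (X * T) + 2 * m * (Y * T) ≡ (t * X + m * Y) * (2 * T)
    double = solve-∀

  walkBound-suc : ∀ k t → 2 * t * walkBound k (t ∸ 1) + 2 * m * walkBound k t ≡ walkBound (suc k) t
  walkBound-suc k t = trans (double t m _ _ (2 ^ k)) (cong (_* 2 ^ suc k) (step t))
    where
    step : ∀ t → t * arrangements k (t ∸ 1) (k ∸ (t ∸ 1)) + m * arrangements k t (k ∸ t)
                 ≡ arrangements (suc k) t (suc k ∸ t)
    step zero    = arrangements-zero k k
    step (suc s) = arrangements-pascal k s (k ∸ s) (k ∸ suc s) (m*m^[k∸1+s]*kC[1+s] k s)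

  tailWalkBound-suc : ∀ k t → t ≤ k → 2 * t * tailWalkBound k (t ∸ 1) + 2 * m * tailWalkBound k t ≡ tailWalkBound (suc k) t
  tailWalkBound-suc k t t≤k = trans (double t m _ _ (2 ^ suc k)) (cong (_* 2 ^ suc (suc k)) (step t t≤k))
    where
    step : ∀ t → t ≤ k → t * arrangements (suc k) (t ∸ 1) (k ∸ (t ∸ 1)) + m * arrangements (suc k) t (k ∸ t)
                         ≡ arrangements (suc (suc k)) t (suc k ∸ t)
    step zero    _   = arrangements-zero (suc k) k
    step (suc s) s<k = arrangements-pascal (suc k) s (k ∸ s) (k ∸ suc s)
                         (cong (_* (suc k C suc s)) (m*m^[k∸1+s] s<k))

  walkBound-diag : ∀ k → walkBound k k ≡ k ! * 2 ^ k
  walkBound-diag k rewrite nCn≡1 k | n∸n≡0 k = cong (_* 2 ^ k) (trans (*-identityʳ (1 * k !)) (*-identityˡ (k !)))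

  tailWalkBound≡ : ∀ k t → tailWalkBound k t ≡ (suc k C t) * (t !) * m ^ (suc k ∸ t ∸ 1) * 2 ^ suc k
  tailWalkBound≡ k t = cong (λ e → (suc k C t) * (t !) * m ^ e * 2 ^ suc k)
    (sym (trans (∸-+-assoc (suc k) t 1) (cong (suc k ∸_) (+-comm t 1))))

  tailWalkBound-diag : ∀ k → 2 * k * tailWalkBound (k ∸ 1) (k ∸ 1) + 2 * walkBound k k ≡ tailWalkBound k k
  tailWalkBound-diag zero = refl
  tailWalkBound-diag (suc j)
    rewrite [1+n]Cn≡1+n j | [1+n]Cn≡1+n (suc j) | nCn≡1 (suc j) | n∸n≡0 j = lemma j (j !) (2 ^ j)
    where
    lemma : ∀ j f T → 2 * suc j * (suc j * f * 1 * (2 * T)) + 2 * (1 * (suc j * f) * 1 * (2 * T))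
                      ≡ suc (suc j) * (suc j * f) * 1 * (2 * (2 * T))
    lemma = solve-∀

-- Counting walks

sum-map-allSteps : ∀ {n} (g : Step n → ℕ) → Listℕ.sum (map g (allSteps n)) ≡ ∑³ (λ a b c → g (a , b , c))
sum-map-allSteps {n} g = begin
  Listℕ.sum (map g (allSteps n))
    ≡⟨ sum-map-cartesianProduct g (allFin n) _ ⟩
  Listℕ.sum (map (λ a → sumᵃ a (cartesianProduct (allFin n) (allFin n))) (allFin n))
    ≡⟨ sum-map-allFin (λ a → sumᵃ a (cartesianProduct (allFin n) (allFin n))) ⟩
  ∑[ a < n ] sumᵃ a (cartesianProduct (allFin n) (allFin n))
    ≡⟨ sum-cong-≗ {n} (λ a → trans (sum-map-cartesianProduct (g ∘ (a ,_)) (allFin n) (allFin n))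
         (trans (sum-map-allFin (λ b → Listℕ.sum (map (λ c → g (a , b , c)) (allFin n))))
                (sum-cong-≗ {n} (λ b → sum-map-allFin (λ c → g (a , b , c)))))) ⟩
  ∑³ (λ a b c → g (a , b , c)) ∎
  where
  open ≡-Reasoning
  sumᵃ : Fin n → List (Fin n × Fin n) → ℕ
  sumᵃ a bcs = Listℕ.sum (map (g ∘ (a ,_)) bcs)

count-allStepLists-suc : ∀ {n p} {P : Pred (List (Step n)) p} (P? : Decidable P) k →
  count P? (allStepLists n (suc k)) ≡ ∑³ (λ a b c → count (P? ∘ ((a , b , c) ∷_)) (allStepLists n k))
count-allStepLists-suc {n} P? k = begin
  count P? (map cons pairs)                                 ≡⟨ count≡sum𝟙 P? (map cons pairs) ⟩
  Listℕ.sum (map (𝟙 ∘ P?) (map cons pairs))                 ≡⟨ cong Listℕ.sum (map-∘ pairs) ⟨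
  Listℕ.sum (map (𝟙 ∘ P? ∘ cons) pairs)                     ≡⟨ sum-map-cartesianProduct (𝟙 ∘ P? ∘ cons) (allSteps n) css ⟩
  Listℕ.sum (map (λ s → Listℕ.sum (map (𝟙 ∘ P? ∘ (s ∷_)) css)) (allSteps n))
    ≡⟨ cong Listℕ.sum (map-cong (λ s → count≡sum𝟙 (P? ∘ (s ∷_)) css) (allSteps n)) ⟨
  Listℕ.sum (map (λ s → count (P? ∘ (s ∷_)) css) (allSteps n))
    ≡⟨ sum-map-allSteps (λ s → count (P? ∘ (s ∷_)) css) ⟩
  ∑³ (λ a b c → count (P? ∘ ((a , b , c) ∷_)) css) ∎
  where
  open ≡-Reasoning
  css : List (List (Step n))
  css = allStepLists n k
  pairs : List (Step n × List (Step n))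
  pairs = cartesianProduct (allSteps n) css
  cons : Step n × List (Step n) → List (Step n)
  cons (s , cs) = s ∷ cs

module Walks {n : ℕ} (H : Family n) (isDesign : IsDesign H) where

  open Design H isDesign
  open WalkBounds (n ∸ 1)

  WalkR : Fin n → Subset n → List (Step n) → Set
  WalkR u Z cs = Linked H u cs × Z ⊆ CR cs

  walkR? : ∀ u Z → Decidable (WalkR u Z)
  walkR? u Z cs = Linked? H u cs ×-dec (Z ⊆? CR cs)

  WalkL : Fin n → Fin n → Subset n → List (Step n) → Set
  WalkL u w Z cs = Linked H u cs × tailOf u cs ≡ w × Z ⊆ CL cs

  walkL? : ∀ u w Z → Decidable (WalkL u w Z)
  walkL? u w Z cs = Linked? H u cs ×-dec ((tailOf u cs ≟ᶠ w) ×-dec (Z ⊆? CL cs))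

  #walksR : Fin n → ℕ → Subset n → ℕ
  #walksR u k Z = count (walkR? u Z) (allStepLists n k)

  #walksL : Fin n → ℕ → Fin n → Subset n → ℕ
  #walksL u k w Z = count (walkL? u w Z) (allStepLists n k)

  countR≤#walksR : ∀ u r Z → countR H u r Z ≤ #walksR u r Z
  countR≤#walksR u r Z = count-mono _ (walkR? u Z) (λ _ ((_ , _ , L) , Z⊆) → L , Z⊆) (allStepLists n r)

  countL≤#walksL : ∀ u r w Z → countL H u r w Z ≤ #walksL u r w Z
  countL≤#walksL u r w Z = count-mono _ (walkL? u w Z) (λ _ ((_ , _ , L) , W) → L , W) (allStepLists n r)

  #walksR-suc : ∀ u k Z → #walksR u (suc k) Z ≤ ∑³ (λ a b c → link u a b c * #walksR c k (Z - b))
  #walksR-suc u k Z = ≤-trans (≤-reflexive (count-allStepLists-suc (walkR? u Z) k)) (∑³-mono-≤ λ a b c →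
    count-≤-𝟙* _ (walkR? c (Z - b)) (link? u a b c)
      (λ _ ((L , W) , Z⊆) → L , W , p⊆⁅x⁆∪q⇒p-x⊆q Z⊆) (allStepLists n k))

  #walksL-suc : ∀ u k w Z → #walksL u (suc k) w Z ≤ ∑³ (λ a b c → link u a b c * #walksL c k w (Z - a))
  #walksL-suc u k w Z = ≤-trans (≤-reflexive (count-allStepLists-suc (walkL? u w Z) k)) (∑³-mono-≤ λ a b c →
    count-≤-𝟙* _ (walkL? c w (Z - a)) (link? u a b c)
      (λ _ ((L , W) , tail≡w , Z⊆) → L , W , tail≡w , p⊆⁅x⁆∪q⇒p-x⊆q Z⊆) (allStepLists n k))

  #walksR≤walkBound : ∀ k u Z → #walksR u k Z ≤ walkBound k ∣ Z ∣
  #walksR≤walkBound zero u Z = begin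
    #walksR u 0 Z       ≡⟨ count-[x] (walkR? u Z) [] ⟩
    𝟙 (walkR? u Z [])   ≤⟨ 𝟙-mono (walkR? u Z []) (∣ Z ∣ ≟ 0) (p⊆∅⇒∣p∣≡0 ∘ proj₂) ⟩
    𝟙 (∣ Z ∣ ≟ 0)       ≡⟨ walkBound-zero ∣ Z ∣ ⟨
    walkBound 0 ∣ Z ∣   ∎
    where open ≤-Reasoning
  #walksR≤walkBound (suc k) u Z = begin
    #walksR u (suc k) Z
      ≤⟨ #walksR-suc u k Z ⟩
    ∑³ (λ a b c → link u a b c * #walksR c k (Z - b))
      ≤⟨ ∑³-mono-≤ (λ a b c → *-monoʳ-≤ (link u a b c) (remove-bound b c)) ⟩
    ∑³ (λ a b c → link u a b c * (𝟙 (b ∈? Z) * walkBound k (t ∸ 1) + walkBound k t))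
      ≡⟨ ∑³-*-distrib (link u) (λ a b c → 𝟙 (b ∈? Z)) (λ _ _ _ → walkBound k t) (walkBound k (t ∸ 1)) ⟩
    ∑³ (λ a b c → link u a b c * 𝟙 (b ∈? Z)) * walkBound k (t ∸ 1) + ∑³ (λ a b c → link u a b c * walkBound k t)
      ≤⟨ +-mono-≤ (*-monoˡ-≤ (walkBound k (t ∸ 1)) (∑³link*𝟙[b∈Z] u Z))
                  (≤-trans (≤-reflexive (∑³-*ʳ (link u) (walkBound k t)))
                           (*-monoˡ-≤ (walkBound k t) (∑³link≤2[n∸1] u))) ⟩
    2 * t * walkBound k (t ∸ 1) + 2 * (n ∸ 1) * walkBound k t
      ≡⟨ walkBound-suc k t ⟩
    walkBound (suc k) t ∎
    where
    open ≤-Reasoning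
    t : ℕ
    t = ∣ Z ∣
    remove-bound : ∀ b c → #walksR c k (Z - b) ≤ 𝟙 (b ∈? Z) * walkBound k (t ∸ 1) + walkBound k t
    remove-bound b c = ≤-𝟙*-+ (b ∈? Z)
      (λ b∈Z → ≤-trans (#walksR≤walkBound k c (Z - b))
                       (≤-reflexive (cong (walkBound k) (x∈p⇒∣p-x∣≡∣p∣∸1 b∈Z))))
      (λ b∉Z → ≤-trans (#walksR≤walkBound k c (Z - b)) (≤-reflexive (cong (walkBound k ∘ ∣_∣) (x∉p⇒p-x≡p b∉Z))))

  ∑#walksL≤walkBound : ∀ k w Z → ∑[ u < n ] #walksL u k w Z ≤ walkBound k ∣ Z ∣
  ∑#walksL≤walkBound zero w Z = begin
    ∑[ u < n ] #walksL u 0 w Z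
      ≡⟨ sum-cong-≗ {n} (λ u → count-[x] (walkL? u w Z) []) ⟩
    ∑[ u < n ] 𝟙 (walkL? u w Z [])
      ≤⟨ ∑-mono-≤ (λ u → 𝟙≤𝟙*𝟙 (walkL? u w Z []) (∣ Z ∣ ≟ 0) (u ∈? ⁅ w ⁆)
           (λ (_ , u≡w , Z⊆∅) → p⊆∅⇒∣p∣≡0 Z⊆∅ , subst (_∈ ⁅ w ⁆) (sym u≡w) (x∈⁅x⁆ w))) ⟩
    ∑[ u < n ] (𝟙 (∣ Z ∣ ≟ 0) * 𝟙 (u ∈? ⁅ w ⁆))
      ≡⟨ *-distribˡ-sum (𝟙 (∣ Z ∣ ≟ 0)) (λ u → 𝟙 (u ∈? ⁅ w ⁆)) ⟨
    𝟙 (∣ Z ∣ ≟ 0) * ∑[ u < n ] 𝟙 (u ∈? ⁅ w ⁆)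
      ≡⟨ trans (cong (𝟙 (∣ Z ∣ ≟ 0) *_) (∑𝟙∈⁅x⁆ w)) (*-identityʳ _) ⟩
    𝟙 (∣ Z ∣ ≟ 0)
      ≡⟨ walkBound-zero ∣ Z ∣ ⟨
    walkBound 0 ∣ Z ∣ ∎
    where open ≤-Reasoning
  ∑#walksL≤walkBound (suc k) w Z = begin
    ∑[ u < n ] #walksL u (suc k) w Z
      ≤⟨ ∑-mono-≤ (λ u → ≤-trans (#walksL-suc u k w Z)
                                 (∑³-mono-≤ λ a b c → *-monoʳ-≤ (link u a b c) (split a c))) ⟩
    ∑[ u < n ] ∑³ (λ a b c → link u a b c * G a c)
      ≤⟨ ∑∑³link*[a,c] G ⟩
    ∑[ a < n ] ∑[ c < n ] (2 * 𝟙 (a ∈? ∁ ⁅ c ⁆) * G a c)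
      ≤⟨ ∑-mono-≤ (λ a → ∑-mono-≤ λ c → drop-guard a c) ⟩
    ∑[ a < n ] ∑[ c < n ] (removed a c + kept a c)
      ≡⟨ trans (sum-cong-≗ {n} λ a → ∑-distrib-+ (removed a) (kept a))
               (∑-distrib-+ (λ a → ∑[ c < n ] removed a c) (λ a → ∑[ c < n ] kept a c)) ⟩
    ∑[ a < n ] ∑[ c < n ] removed a c + ∑[ a < n ] ∑[ c < n ] kept a c
      ≤⟨ +-mono-≤ removed-part kept-part ⟩
    2 * t * walkBound k (t ∸ 1) + 2 * (n ∸ 1) * walkBound k t
      ≡⟨ walkBound-suc k t ⟩
    walkBound (suc k) t ∎
    where
    open ≤-Reasoning
    t : ℕ
    t = ∣ Z ∣
    Y₁ : Fin n → Fin n → ℕ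
    Y₁ a c = #walksL c k w (Z - a)
    Y₂ : Fin n → ℕ
    Y₂ c = #walksL c k w Z
    G : Fin n → Fin n → ℕ
    G a c = 𝟙 (a ∈? Z) * Y₁ a c + Y₂ c
    split : ∀ a c → Y₁ a c ≤ G a c
    split a c = ≤-𝟙*-+ (a ∈? Z) (λ _ → ≤-refl) (λ a∉Z → ≤-reflexive (cong (#walksL c k w) (x∉p⇒p-x≡p a∉Z)))
    removed kept : Fin n → Fin n → ℕ
    removed a c = 2 * (𝟙 (a ∈? Z) * Y₁ a c)
    kept    a c = 2 * 𝟙 (a ∈? ∁ ⁅ c ⁆) * Y₂ c
    drop-guard : ∀ a c → 2 * 𝟙 (a ∈? ∁ ⁅ c ⁆) * G a c ≤ removed a c + kept a c
    drop-guard a c = ≤-trans (≤-reflexive (*-distribˡ-+ (2 * 𝟙 (a ∈? ∁ ⁅ c ⁆)) (𝟙 (a ∈? Z) * Y₁ a c) (Y₂ c)))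
      (+-monoˡ-≤ _ (*-monoˡ-≤ (𝟙 (a ∈? Z) * Y₁ a c) (*-monoʳ-≤ 2 (𝟙≤1 (a ∈? ∁ ⁅ c ⁆)))))
    removed-part : ∑[ a < n ] ∑[ c < n ] removed a c ≤ 2 * t * walkBound k (t ∸ 1)
    removed-part = begin
      ∑[ a < n ] ∑[ c < n ] (2 * (𝟙 (a ∈? Z) * Y₁ a c))
        ≡⟨ sum-cong-≗ {n} (λ a → trans (cong (2 *_) (*-distribˡ-sum (𝟙 (a ∈? Z)) (Y₁ a)))
                                       (*-distribˡ-sum 2 (λ c → 𝟙 (a ∈? Z) * Y₁ a c))) ⟨
      ∑[ a < n ] (2 * (𝟙 (a ∈? Z) * ∑[ c < n ] Y₁ a c))
        ≡⟨ *-distribˡ-sum 2 (λ a → 𝟙 (a ∈? Z) * ∑[ c < n ] Y₁ a c) ⟨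
      2 * ∑[ a < n ] (𝟙 (a ∈? Z) * ∑[ c < n ] Y₁ a c)
        ≤⟨ *-monoʳ-≤ 2 (∑𝟙∈*≤∣p∣* Z (λ {a} a∈Z → ≤-trans (∑#walksL≤walkBound k w (Z - a))
                                       (≤-reflexive (cong (walkBound k) (x∈p⇒∣p-x∣≡∣p∣∸1 a∈Z))))) ⟩
      2 * (t * walkBound k (t ∸ 1))
        ≡⟨ *-assoc 2 t _ ⟨
      2 * t * walkBound k (t ∸ 1) ∎
    kept-part : ∑[ a < n ] ∑[ c < n ] kept a c ≤ 2 * (n ∸ 1) * walkBound k t
    kept-part = begin
      ∑[ a < n ] ∑[ c < n ] (2 * 𝟙 (a ∈? ∁ ⁅ c ⁆) * Y₂ c)
        ≡⟨ ∑-comm (λ a c → 2 * 𝟙 (a ∈? ∁ ⁅ c ⁆) * Y₂ c) ⟩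
      ∑[ c < n ] ∑[ a < n ] (2 * 𝟙 (a ∈? ∁ ⁅ c ⁆) * Y₂ c)
        ≡⟨ sum-cong-≗ {n} (λ c → trans (cong (_* Y₂ c) (*-distribˡ-sum 2 (λ a → 𝟙 (a ∈? ∁ ⁅ c ⁆))))
                                       (*-distribʳ-sum (Y₂ c) (λ a → 2 * 𝟙 (a ∈? ∁ ⁅ c ⁆)))) ⟨
      ∑[ c < n ] (2 * ∑[ a < n ] 𝟙 (a ∈? ∁ ⁅ c ⁆) * Y₂ c)
        ≡⟨ sum-cong-≗ {n} (λ c → cong (λ x → 2 * x * Y₂ c) (∑𝟙∈∁⁅x⁆ c)) ⟩
      ∑[ c < n ] (2 * (n ∸ 1) * Y₂ c)
        ≡⟨ *-distribˡ-sum (2 * (n ∸ 1)) Y₂ ⟨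
      2 * (n ∸ 1) * ∑[ c < n ] Y₂ c
        ≤⟨ *-monoʳ-≤ (2 * (n ∸ 1)) (∑#walksL≤walkBound k w Z) ⟩
      2 * (n ∸ 1) * walkBound k t ∎

  #walksL≤tailWalkBound : ∀ k u w Z → ∣ Z ∣ ≤ k → #walksL u (suc k) w Z ≤ tailWalkBound k ∣ Z ∣

  #walksL-remove≤ : ∀ k c w Z {a} → ∣ Z ∣ ≤ k → a ∈ Z →
                    #walksL c k w (Z - a) ≤ tailWalkBound (k ∸ 1) (∣ Z ∣ ∸ 1)
  #walksL-remove≤ zero    c w Z t≤0   a∈Z = ⊥-elim (n≮0 (<-≤-trans (x∈p⇒∣p-x∣<∣p∣ a∈Z) t≤0))
  #walksL-remove≤ (suc k) c w Z {a} t≤1+k a∈Z = ≤-trans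
    (#walksL≤tailWalkBound k c w (Z - a) (≤-pred (subst (_≤ suc k) (sym (x∈p⇒1+∣p-x∣≡∣p∣ a∈Z)) t≤1+k)))
    (≤-reflexive (cong (tailWalkBound k) (x∈p⇒∣p-x∣≡∣p∣∸1 a∈Z)))

  #walksL-first-step : ∀ k u w Z → ∣ Z ∣ ≤ k →
    #walksL u (suc k) w Z ≤ 2 * ∣ Z ∣ * tailWalkBound (k ∸ 1) (∣ Z ∣ ∸ 1)
                            + ∑³ (λ a b c → link u a b c * #walksL c k w Z)
  #walksL-first-step k u w Z t≤k = begin
    #walksL u (suc k) w Z
      ≤⟨ #walksL-suc u k w Z ⟩
    ∑³ (λ a b c → link u a b c * #walksL c k w (Z - a))
      ≤⟨ ∑³-mono-≤ (λ a b c → *-monoʳ-≤ (link u a b c) (≤-𝟙*-+ (a ∈? Z) (#walksL-remove≤ k c w Z t≤k)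
           (λ a∉Z → ≤-reflexive (cong (#walksL c k w) (x∉p⇒p-x≡p a∉Z))))) ⟩
    ∑³ (λ a b c → link u a b c * (𝟙 (a ∈? Z) * X + #walksL c k w Z))
      ≡⟨ ∑³-*-distrib (link u) (λ a b c → 𝟙 (a ∈? Z)) (λ a b c → #walksL c k w Z) X ⟩
    ∑³ (λ a b c → link u a b c * 𝟙 (a ∈? Z)) * X + ∑³ (λ a b c → link u a b c * #walksL c k w Z)
      ≤⟨ +-monoˡ-≤ _ (*-monoˡ-≤ X (∑³link*𝟙[a∈Z] u Z)) ⟩
    2 * ∣ Z ∣ * X + ∑³ (λ a b c → link u a b c * #walksL c k w Z) ∎
    where
    open ≤-Reasoning
    X : ℕ
    X = tailWalkBound (k ∸ 1) (∣ Z ∣ ∸ 1)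

  first-step≤tailWalkBound : ∀ k u w Z → ∣ Z ∣ < k ⊎ ∣ Z ∣ ≡ k →
    2 * ∣ Z ∣ * tailWalkBound (k ∸ 1) (∣ Z ∣ ∸ 1) + ∑³ (λ a b c → link u a b c * #walksL c k w Z)
      ≤ tailWalkBound k ∣ Z ∣
  first-step≤tailWalkBound (suc k) u w Z (inj₁ (s≤s t≤k)) = begin
    2 * t * X + ∑³ (λ a b c → link u a b c * #walksL c (suc k) w Z)
      ≤⟨ +-monoʳ-≤ (2 * t * X) (∑³-mono-≤ λ a b c → *-monoʳ-≤ (link u a b c) (#walksL≤tailWalkBound k c w Z t≤k)) ⟩
    2 * t * X + ∑³ (λ a b c → link u a b c * tailWalkBound k t)
      ≤⟨ +-monoʳ-≤ (2 * t * X) (≤-trans (≤-reflexive (∑³-*ʳ (link u) (tailWalkBound k t)))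
                                         (*-monoˡ-≤ (tailWalkBound k t) (∑³link≤2[n∸1] u))) ⟩
    2 * t * X + 2 * (n ∸ 1) * tailWalkBound k t
      ≡⟨ tailWalkBound-suc k t t≤k ⟩
    tailWalkBound (suc k) t ∎
    where
    open ≤-Reasoning
    t : ℕ
    t = ∣ Z ∣
    X : ℕ
    X = tailWalkBound k (t ∸ 1)
  first-step≤tailWalkBound k u w Z (inj₂ t≡k) = begin
    2 * t * X + ∑³ (λ a b c → link u a b c * #walksL c k w Z)
      ≤⟨ +-monoʳ-≤ (2 * t * X) (∑³link*[c] u (λ c → #walksL c k w Z)) ⟩
    2 * t * X + 2 * ∑[ c < n ] #walksL c k w Z
      ≤⟨ +-monoʳ-≤ (2 * t * X) (*-monoʳ-≤ 2 (∑#walksL≤walkBound k w Z)) ⟩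
    2 * t * X + 2 * walkBound k t
      ≡⟨ subst (λ s → 2 * s * tailWalkBound (k ∸ 1) (s ∸ 1) + 2 * walkBound k s ≡ tailWalkBound k s)
               (sym t≡k) (tailWalkBound-diag k) ⟩
    tailWalkBound k t ∎
    where
    open ≤-Reasoning
    t : ℕ
    t = ∣ Z ∣
    X : ℕ
    X = tailWalkBound (k ∸ 1) (t ∸ 1)

  #walksL≤tailWalkBound k u w Z t≤k =
    ≤-trans (#walksL-first-step k u w Z t≤k) (first-step≤tailWalkBound k u w Z (m≤n⇒m<n∨m≡n t≤k))

claim4p7 : (n : ℕ) (H : Family n) → IsDesign H → (u : Fin n) (r : ℕ) → r ≥ 1 →
    (Z : Subset n) (t : ℕ) → ∣ Z ∣ ≡ t → t ≤ r →
      (countR H u r Z ≤ (r C t) * (t !) * (n ∸ 1) ^ (r ∸ t) * 2 ^ r)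
      × ((w : Fin n) →
           (t ≤ r ∸ 1 → countL H u r w Z ≤ (r C t) * (t !) * (n ∸ 1) ^ (r ∸ t ∸ 1) * 2 ^ r)
           × (t ≡ r → countL H u r w Z ≤ (r !) * 2 ^ r))
claim4p7 n H isDesign u (suc k) (s≤s z≤n) Z _ refl _ = chainsR , λ w → chainsL w , chainsL-full w
  where
  open Walks H isDesign
  open WalkBounds (n ∸ 1)
  r : ℕ
  r = suc k
  t : ℕ
  t = ∣ Z ∣

  chainsR : countR H u r Z ≤ walkBound r t
  chainsR = ≤-trans (countR≤#walksR u r Z) (#walksR≤walkBound r u Z)

  chainsL : ∀ w → t ≤ k → countL H u r w Z ≤ (r C t) * (t !) * (n ∸ 1) ^ (r ∸ t ∸ 1) * 2 ^ r
  chainsL w t≤k = ≤-trans (countL≤#walksL u r w Z)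
    (≤-trans (#walksL≤tailWalkBound k u w Z t≤k) (≤-reflexive (tailWalkBound≡ k t)))

  chainsL-full : ∀ w → t ≡ r → countL H u r w Z ≤ (r !) * 2 ^ r
  chainsL-full w t≡r = ≤-trans (countL≤#walksL u r w Z)
    (≤-trans (term≤∑ (λ v → #walksL v r w Z) u)
    (≤-trans (∑#walksL≤walkBound r w Z) (≤-reflexive (trans (cong (walkBound r) t≡r) (walkBound-diag r)))))
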